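{- Let $k>100$ and $n>100k^2$ be integers. Let $\Pi=(S_1,\ldots,S_{100k^2})$ be a random $100k^2$-way partition of $[n]$, obtained by assigning each $i\in[n]$ independently and uniformly at random to one of the $100k^2$ classes (some classes may be empty). For $J\subseteq[n]$ let $N(\Pi,J)$ denote the number of classes $S_i$ containing an odd number of elements of $J$. Then: (i) for every $J\subseteq[n]$ with $|J|\le k$, $\Pr_\Pi[N(\Pi,J)=|J|]>9/10$; (ii) for every $J\subseteq[n]$ with $|J|>k$, $\Pr_\Pi[N(\Pi,J)>k]>9/10$. -}

module Defs where

open import Data.Nat using (ℕ; zero; suc; _+_; _*_; _%_; _≡ᵇ_)
open import Data.Bool using (Bool; true; false; if_then_else_; _∧_)
open import Data.Fin using (Fin)
open import Data.Fin.Properties using (_≟_)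
open import Data.Vec using (Vec; []; _∷_)
open import Data.List using (List; [_]; map; concatMap; filter; length; allFin)
open import Data.Fin.Subset using (Subset)
open import Relation.Nullary.Decidable using (⌊_⌋)

-- A partition Π of [n] = Fin n into m labelled (possibly empty) classes,
-- given by the class assignment i ↦ Π[i].
Assignment : ℕ → ℕ → Set
Assignment m n = Vec (Fin m) n

-- All m^n assignments (the uniform probability space).
allAssignments : (m n : ℕ) → List (Assignment m n)
allAssignments m zero = [ [] ]
allAssignments m (suc n) =
  concatMap (λ v → map (λ c → c ∷ v) (allFin m)) (allAssignments m n)

classCount : ∀ {m n} → Assignment m n → Subset n → Fin m → ℕ
classCount [] [] c = 0
classCount (x ∷ xs) (b ∷ bs) c =
  (if b ∧ ⌊ x ≟ c ⌋ then 1 else 0) + classCount xs bs c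

isOdd : ℕ → Bool
isOdd a = (a % 2) ≡ᵇ 1

N : ∀ {m n} → Assignment m n → Subset n → ℕ
N {m} Π J = length (filter (λ c → isOdd (classCount Π J c) Data.Bool.≟ true) (allFin m))

countEvent : (m n : ℕ) → (Assignment m n → Bool) → ℕ
countEvent m n P = length (filter (λ Π → P Π Data.Bool.≟ true) (allAssignments m n))

-- Throw the elements of J into the m = 100k² classes one at a time, starting from class sizes g
-- with w odd classes. An element raises the number of odd classes by one unless it lands in one
-- of the at most w + |J| classes that are currently odd, which has probability at most
-- (w + |J|)/m; by the union bound Pr[N ≠ w + |J|] ≤ |J|(w + |J|)/m, and w = 0 gives (i).
-- For (ii) condition on the classes of all but the last k + 1 elements of J. Each element changes
-- the number of odd classes by at most one, so if more than 2k + 1 classes are odd at that point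
-- N > k is certain; otherwise the bound above with w ≤ 2k + 1 gives Pr[N ≤ k] ≤ (k + 1)(3k + 2)/m.

module Submission where

open import Defs
open import Data.Nat using (ℕ; zero; suc; _+_; _*_; _^_; _<_; _≤_; _≡ᵇ_; _<ᵇ_; _%_; z≤n; s≤s; z<s; >-nonZero)
open import Data.Nat.Properties
open import Data.Nat.DivMod using ([m+n]%n≡m%n)
open import Data.Nat.ListAction using () renaming (sum to sumˡ)
open import Data.Nat.ListAction.Properties using () renaming (sum-++ to sumˡ-++)
open import Data.Nat.Tactic.RingSolver using (solve-∀)
open import Algebra.Properties.Semiring.Sum +-*-semiring
  using (sum-syntax; sum-cong-≗; sum-remove; ∑-distrib-+; ∑-comm; *-distribˡ-sum)
import Algebra.Properties.CommutativeSemigroup as CommutativeSemigroupProperties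
open import Data.Bool using (Bool; true; false; if_then_else_; not; T) renaming (_≟_ to _≟𝔹_)
open import Data.Bool.Properties using (not-involutive)
open import Data.Fin using (Fin; zero; suc; punchIn)
open import Data.Fin.Properties using (punchInᵢ≢i) renaming (_≟_ to _≟ᶠ_)
open import Data.Fin.Subset using (Subset; ∣_∣)
open import Data.Vec using ([]; _∷_)
open import Data.List using (List; map; concatMap; filter; length; allFin; tabulate)
open import Data.List.Properties using (map-++; map-∘; map-cong; map-tabulate)
open import Data.Product using (_×_; _,_)
open import Data.Empty using (⊥-elim)
open import Function using (_∘_; id)
open import Relation.Binary.PropositionalEquality
open import Relation.Nullary using (yes; no; contradiction)
open import Relation.Nullary.Decidable using (⌊_⌋)

module +-CSemigroup = CommutativeSemigroupProperties +-commutativeSemigroup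
module *-CSemigroup = CommutativeSemigroupProperties *-commutativeSemigroup

𝟙 : Bool → ℕ
𝟙 b = if b then 1 else 0

𝟙-complement : ∀ b → 𝟙 b + 𝟙 (not b) ≡ 1
𝟙-complement true  = refl
𝟙-complement false = refl

𝟙-not-≡ᵇ : ∀ {a b} → a ≡ b → 𝟙 (not (a ≡ᵇ b)) ≡ 0
𝟙-not-≡ᵇ {a} refl with a ≡ᵇ a | ≡⇒≡ᵇ a a refl
... | true  | _  = refl
... | false | ()

𝟙-not-antitone : ∀ {a b} → (T a → T b) → 𝟙 (not b) ≤ 𝟙 (not a)
𝟙-not-antitone {false} {true}  _   = z≤n
𝟙-not-antitone {false} {false} _   = ≤-refl
𝟙-not-antitone {true}  {true}  _   = z≤n
𝟙-not-antitone {true}  {false} a⇒b = ⊥-elim (a⇒b _)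

∑-mono-≤ : ∀ {p} {f g : Fin p → ℕ} → (∀ i → f i ≤ g i) → ∑[ i < p ] f i ≤ ∑[ i < p ] g i
∑-mono-≤ {zero}  _   = z≤n
∑-mono-≤ {suc p} f≤g = +-mono-≤ (f≤g zero) (∑-mono-≤ (f≤g ∘ suc))

∑-const : ∀ p a → ∑[ i < p ] a ≡ p * a
∑-const zero    a = refl
∑-const (suc p) a = cong (a +_) (∑-const p a)

length-filter≡sum-𝟙 : ∀ {A : Set} (P : A → Bool) (xs : List A) →
  length (filter (λ x → P x ≟𝔹 true) xs) ≡ sumˡ (map (𝟙 ∘ P) xs)
length-filter≡sum-𝟙 P List.[] = refl
length-filter≡sum-𝟙 P (x List.∷ xs) with P x
... | true  = cong suc (length-filter≡sum-𝟙 P xs)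
... | false = length-filter≡sum-𝟙 P xs

sumˡ-concatMap : ∀ {A B : Set} (f : B → ℕ) (g : A → List B) (xs : List A) →
  sumˡ (map f (concatMap g xs)) ≡ sumˡ (map (sumˡ ∘ map f ∘ g) xs)
sumˡ-concatMap f g List.[] = refl
sumˡ-concatMap f g (x List.∷ xs) = begin
  sumˡ (map f (g x Data.List.++ concatMap g xs))
    ≡⟨ cong sumˡ (map-++ f (g x) (concatMap g xs)) ⟩
  sumˡ (map f (g x) Data.List.++ map f (concatMap g xs))
    ≡⟨ sumˡ-++ (map f (g x)) (map f (concatMap g xs)) ⟩
  sumˡ (map f (g x)) + sumˡ (map f (concatMap g xs))
    ≡⟨ cong (sumˡ (map f (g x)) +_) (sumˡ-concatMap f g xs) ⟩
  sumˡ (map f (g x)) + sumˡ (map (sumˡ ∘ map f ∘ g) xs) ∎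
  where open ≡-Reasoning

sumˡ-allFin : ∀ p (f : Fin p → ℕ) → sumˡ (map f (allFin p)) ≡ ∑[ i < p ] f i
sumˡ-allFin p f = trans (cong sumˡ (map-tabulate id f)) (sumˡ-tabulate p f)
  where
  sumˡ-tabulate : ∀ p (f : Fin p → ℕ) → sumˡ (tabulate f) ≡ ∑[ i < p ] f i
  sumˡ-tabulate zero    f = refl
  sumˡ-tabulate (suc p) f = cong (f zero +_) (sumˡ-tabulate p (f ∘ suc))

-- m * total m n f ≤ m ^ n * b says that the mean of f over the m ^ n assignments is at most b / m.
total : ∀ m n → (Assignment m n → ℕ) → ℕ
total m zero    f = f []
total m (suc n) f = ∑[ c < m ] total m n (λ Π → f (c ∷ Π))

total-cong : ∀ {m} n {f g : Assignment m n → ℕ} → (∀ Π → f Π ≡ g Π) → total m n f ≡ total m n g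
total-cong zero    f≗g = f≗g []
total-cong (suc n) f≗g = sum-cong-≗ (λ c → total-cong n (λ Π → f≗g (c ∷ Π)))

total-mono-≤ : ∀ {m} n {f g : Assignment m n → ℕ} → (∀ Π → f Π ≤ g Π) → total m n f ≤ total m n g
total-mono-≤ zero    f≤g = f≤g []
total-mono-≤ (suc n) f≤g = ∑-mono-≤ (λ c → total-mono-≤ n (λ Π → f≤g (c ∷ Π)))

total-const : ∀ m n a → total m n (λ _ → a) ≡ m ^ n * a
total-const m zero    a = sym (+-identityʳ a)
total-const m (suc n) a = begin
  ∑[ c < m ] total m n (λ _ → a) ≡⟨ sum-cong-≗ {m} (λ _ → total-const m n a) ⟩
  ∑[ c < m ] (m ^ n * a)         ≡⟨ ∑-const m (m ^ n * a) ⟩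
  m * (m ^ n * a)                ≡⟨ *-assoc m (m ^ n) a ⟨
  m ^ suc n * a                  ∎
  where open ≡-Reasoning

total-+ : ∀ {m} n (f g : Assignment m n → ℕ) → total m n (λ Π → f Π + g Π) ≡ total m n f + total m n g
total-+ zero    f g = refl
total-+ {m} (suc n) f g = trans (sum-cong-≗ {m} (λ c → total-+ n (λ Π → f (c ∷ Π)) (λ Π → g (c ∷ Π))))
  (∑-distrib-+ (λ c → total m n (λ Π → f (c ∷ Π))) (λ c → total m n (λ Π → g (c ∷ Π))))

total-∑-comm : ∀ {m} n p (h : Fin p → Assignment m n → ℕ) →
  total m n (λ Π → ∑[ i < p ] h i Π) ≡ ∑[ i < p ] total m n (h i)
total-∑-comm zero    p h = refl
total-∑-comm {m} (suc n) p h = trans (sum-cong-≗ {m} (λ c → total-∑-comm n p (λ i Π → h i (c ∷ Π))))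
  (∑-comm (λ c i → total m n (λ Π → h i (c ∷ Π))))

total-𝟙-complement : ∀ m n (P : Assignment m n → Bool) →
  total m n (λ Π → 𝟙 (P Π)) + total m n (λ Π → 𝟙 (not (P Π))) ≡ m ^ n
total-𝟙-complement m n P = begin
  total m n (𝟙 ∘ P) + total m n (𝟙 ∘ not ∘ P) ≡⟨ total-+ n _ _ ⟨
  total m n (λ Π → 𝟙 (P Π) + 𝟙 (not (P Π)))  ≡⟨ total-cong n (𝟙-complement ∘ P) ⟩
  total m n (λ _ → 1)                        ≡⟨ total-const m n 1 ⟩
  m ^ n * 1                                  ≡⟨ *-identityʳ (m ^ n) ⟩
  m ^ n                                      ∎
  where open ≡-Reasoning

sumˡ-allAssignments : ∀ m n (f : Assignment m n → ℕ) → sumˡ (map f (allAssignments m n)) ≡ total m n f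
sumˡ-allAssignments m zero    f = +-identityʳ (f [])
sumˡ-allAssignments m (suc n) f = begin
  sumˡ (map f (concatMap (λ Π → map (_∷ Π) (allFin m)) (allAssignments m n)))
    ≡⟨ sumˡ-concatMap f _ (allAssignments m n) ⟩
  sumˡ (map (λ Π → sumˡ (map f (map (_∷ Π) (allFin m)))) (allAssignments m n))
    ≡⟨ cong sumˡ (map-cong inner (allAssignments m n)) ⟩
  sumˡ (map (λ Π → ∑[ c < m ] f (c ∷ Π)) (allAssignments m n))
    ≡⟨ sumˡ-allAssignments m n _ ⟩
  total m n (λ Π → ∑[ c < m ] f (c ∷ Π))
    ≡⟨ total-∑-comm n m (λ c Π → f (c ∷ Π)) ⟩
  total m (suc n) f ∎
  where
  open ≡-Reasoning
  inner : ∀ Π → sumˡ (map f (map (_∷ Π) (allFin m))) ≡ ∑[ c < m ] f (c ∷ Π)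
  inner Π = trans (cong sumˡ (sym (map-∘ (allFin m)))) (sumˡ-allFin m (λ c → f (c ∷ Π)))

total-𝟙-≤ : ∀ {m} n (P : Assignment m n → Bool) → total m n (λ Π → 𝟙 (P Π)) ≤ m ^ n
total-𝟙-≤ {m} n P = begin
  total m n (λ Π → 𝟙 (P Π)) ≤⟨ total-mono-≤ n (λ Π → 𝟙≤1 (P Π)) ⟩
  total m n (λ _ → 1)       ≡⟨ total-const m n 1 ⟩
  m ^ n * 1                 ≡⟨ *-identityʳ (m ^ n) ⟩
  m ^ n                     ∎
  where
  open ≤-Reasoning
  𝟙≤1 : ∀ b → 𝟙 b ≤ 1
  𝟙≤1 true  = ≤-refl
  𝟙≤1 false = z≤n

countEvent≡total : ∀ m n (P : Assignment m n → Bool) → countEvent m n P ≡ total m n (λ Π → 𝟙 (P Π))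
countEvent≡total m n P = trans (length-filter≡sum-𝟙 P (allAssignments m n)) (sumˡ-allAssignments m n _)

total-suc-≤ : ∀ {m n} (f : Assignment m (suc n) → ℕ) (b : Fin m → ℕ) →
  (∀ c → m * total m n (λ Π → f (c ∷ Π)) ≤ m ^ n * b c) →
  m * total m (suc n) f ≤ m ^ n * ∑[ c < m ] b c
total-suc-≤ {m} {n} f b bound = begin
  m * ∑[ c < m ] F c       ≡⟨ *-distribˡ-sum m F ⟩
  ∑[ c < m ] (m * F c)     ≤⟨ ∑-mono-≤ bound ⟩
  ∑[ c < m ] (m ^ n * b c) ≡⟨ *-distribˡ-sum (m ^ n) b ⟨
  m ^ n * ∑[ c < m ] b c   ∎
  where
  open ≤-Reasoning
  F : Fin m → ℕ
  F c = total m n (λ Π → f (c ∷ Π))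

total-suc-≤-uniform : ∀ {m n} (f : Assignment m (suc n) → ℕ) (b : ℕ) →
  (∀ c → m * total m n (λ Π → f (c ∷ Π)) ≤ m ^ n * b) →
  m * total m (suc n) f ≤ m ^ suc n * b
total-suc-≤-uniform {m} {n} f b bound = begin
  m * total m (suc n) f   ≤⟨ total-suc-≤ f (λ _ → b) bound ⟩
  m ^ n * ∑[ c < m ] b    ≡⟨ cong (m ^ n *_) (∑-const m b) ⟩
  m ^ n * (m * b)         ≡⟨ *-CSemigroup.x∙yz≈yx∙z (m ^ n) m b ⟩
  m ^ suc n * b           ∎
  where open ≤-Reasoning

Pr>9/10 : ∀ {m n} (P : Assignment m n → Bool) {b} →
  m * total m n (λ Π → 𝟙 (not (P Π))) ≤ m ^ n * b → 10 * b < m →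
  9 * m ^ n < 10 * countEvent m n P
Pr>9/10 {m} {n} P {b} bad≤ 10b<m = +-cancelʳ-< (10 * B) (9 * M) (10 * countEvent m n P) (begin-strict
  9 * M + 10 * B                   <⟨ +-monoʳ-< (9 * M) 10B<M ⟩
  9 * M + M                        ≡⟨ +-comm (9 * M) M ⟩
  10 * M                           ≡⟨ cong (10 *_) (total-𝟙-complement m n P) ⟨
  10 * (G + B)                     ≡⟨ *-distribˡ-+ 10 G B ⟩
  10 * G + 10 * B                  ≡⟨ cong (λ x → 10 * x + 10 * B) (countEvent≡total m n P) ⟨
  10 * countEvent m n P + 10 * B   ∎)
  where
  open ≤-Reasoning
  M = m ^ n
  G = total m n (λ Π → 𝟙 (P Π))
  B = total m n (λ Π → 𝟙 (not (P Π)))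
  instance
    _ = >-nonZero (≤-trans (s≤s z≤n) 10b<m)
    _ = m^n≢0 m n
  10B<M : 10 * B < M
  10B<M = *-cancelˡ-< m (10 * B) M (begin-strict
    m * (10 * B)  ≡⟨ *-CSemigroup.x∙yz≈y∙xz m 10 B ⟩
    10 * (m * B)  ≤⟨ *-monoʳ-≤ 10 bad≤ ⟩
    10 * (M * b)  ≡⟨ *-CSemigroup.x∙yz≈y∙xz 10 M b ⟩
    M * (10 * b)  <⟨ *-monoʳ-< M 10b<m ⟩
    M * m         ≡⟨ *-comm M m ⟩
    m * M         ∎)

isOdd-suc : ∀ a → isOdd (suc a) ≡ not (isOdd a)
isOdd-suc zero    = refl
isOdd-suc (suc a) = begin
  isOdd (suc (suc a))    ≡⟨ cong (λ r → r ≡ᵇ 1) (trans (cong (_% 2) (+-comm 2 a)) ([m+n]%n≡m%n a 2)) ⟩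
  isOdd a                ≡⟨ not-involutive (isOdd a) ⟨
  not (not (isOdd a))    ≡⟨ cong not (isOdd-suc a) ⟨
  not (isOdd (suc a))    ∎
  where open ≡-Reasoning

oddClasses : ∀ {m} → (Fin m → ℕ) → ℕ
oddClasses {m} g = ∑[ c < m ] 𝟙 (isOdd (g c))

oddClasses-cong : ∀ {m} {f g : Fin m → ℕ} → (∀ c → f c ≡ g c) → oddClasses f ≡ oddClasses g
oddClasses-cong {m} f≗g = sum-cong-≗ {m} (cong (𝟙 ∘ isOdd) ∘ f≗g)

oddClasses-zero : ∀ m → oddClasses {m} (λ _ → 0) ≡ 0
oddClasses-zero m = trans (∑-const m 0) (*-zeroʳ m)

-- Written like the summand of classCount, so that classCount (x ∷ Π) (true ∷ J) unfolds to it.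
bump : ∀ {m} → Fin m → (Fin m → ℕ) → Fin m → ℕ
bump x g d = (if ⌊ x ≟ᶠ d ⌋ then 1 else 0) + g d

bump-self : ∀ {m} (x : Fin m) g → bump x g x ≡ suc (g x)
bump-self x g with x ≟ᶠ x
... | yes _   = refl
... | no x≢x = contradiction refl x≢x

bump-other : ∀ {m} (x : Fin m) g {d} → d ≢ x → bump x g d ≡ g d
bump-other x g {d} d≢x with x ≟ᶠ d
... | yes x≡d = contradiction (sym x≡d) d≢x
... | no _    = refl

oddClasses-bump : ∀ {m} (x : Fin m) g {b} → isOdd (g x) ≡ b →
  oddClasses (bump x g) + 𝟙 b ≡ oddClasses g + 𝟙 (not b)
oddClasses-bump {suc m} x g {b} parity = begin
  oddClasses (bump x g) + 𝟙 b                     ≡⟨ cong (_+ 𝟙 b) (sum-remove {i = x} (𝟙 ∘ isOdd ∘ bump x g)) ⟩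
  𝟙 (isOdd (bump x g x)) + rest (bump x g) + 𝟙 b
    ≡⟨ cong₂ (λ a r → a + r + 𝟙 b) (cong 𝟙 (trans (cong isOdd (bump-self x g)) (trans (isOdd-suc (g x)) (cong not parity))))
                                    (sum-cong-≗ {m} (λ j → cong (𝟙 ∘ isOdd) (bump-other x g (punchInᵢ≢i x j)))) ⟩
  𝟙 (not b) + rest g + 𝟙 b                        ≡⟨ +-CSemigroup.xy∙z≈zy∙x (𝟙 (not b)) (rest g) (𝟙 b) ⟩
  𝟙 b + rest g + 𝟙 (not b)                        ≡⟨ cong (λ a → 𝟙 a + rest g + 𝟙 (not b)) parity ⟨
  𝟙 (isOdd (g x)) + rest g + 𝟙 (not b)            ≡⟨ cong (_+ 𝟙 (not b)) (sum-remove {i = x} (𝟙 ∘ isOdd ∘ g)) ⟨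
  oddClasses g + 𝟙 (not b)                        ∎
  where
  open ≡-Reasoning
  rest : (Fin (suc m) → ℕ) → ℕ
  rest h = ∑[ j < m ] 𝟙 (isOdd (h (punchIn x j)))

oddClasses-bump-even : ∀ {m} (x : Fin m) g → isOdd (g x) ≡ false → oddClasses (bump x g) ≡ suc (oddClasses g)
oddClasses-bump-even x g even = begin
  oddClasses (bump x g)       ≡⟨ +-identityʳ _ ⟨
  oddClasses (bump x g) + 0   ≡⟨ oddClasses-bump x g even ⟩
  oddClasses g + 1            ≡⟨ +-comm (oddClasses g) 1 ⟩
  suc (oddClasses g)          ∎
  where open ≡-Reasoning

oddClasses-bump-odd : ∀ {m} (x : Fin m) g → isOdd (g x) ≡ true → oddClasses g ≡ suc (oddClasses (bump x g))
oddClasses-bump-odd x g odd = begin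
  oddClasses g                ≡⟨ +-identityʳ _ ⟨
  oddClasses g + 0            ≡⟨ oddClasses-bump x g odd ⟨
  oddClasses (bump x g) + 1   ≡⟨ +-comm (oddClasses (bump x g)) 1 ⟩
  suc (oddClasses (bump x g)) ∎
  where open ≡-Reasoning

oddClasses-bump-≤ : ∀ {m} (x : Fin m) g → oddClasses g ≤ suc (oddClasses (bump x g))
oddClasses-bump-≤ x g with isOdd (g x) in parity
... | true  = ≤-reflexive (oddClasses-bump-odd x g parity)
... | false = ≤-trans (m≤n+m (oddClasses g) 2) (≤-reflexive (cong suc (sym (oddClasses-bump-even x g parity))))

Nfrom : ∀ {m n} → (Fin m → ℕ) → Assignment m n → Subset n → ℕ
Nfrom g Π J = oddClasses (λ c → classCount Π J c + g c)

N≡Nfrom-0 : ∀ {m n} (Π : Assignment m n) J → N Π J ≡ Nfrom (λ _ → 0) Π J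
N≡Nfrom-0 {m} Π J = begin
  N Π J                                                        ≡⟨ length-filter≡sum-𝟙 _ (allFin m) ⟩
  sumˡ (map (λ c → 𝟙 (isOdd (classCount Π J c))) (allFin m))  ≡⟨ sumˡ-allFin m _ ⟩
  oddClasses (classCount Π J)                                  ≡⟨ oddClasses-cong {f = classCount Π J} (λ c → sym (+-identityʳ _)) ⟩
  Nfrom (λ _ → 0) Π J                                          ∎
  where open ≡-Reasoning

Nfrom-∷-true : ∀ {m n} g (x : Fin m) (Π : Assignment m n) J → Nfrom g (x ∷ Π) (true ∷ J) ≡ Nfrom (bump x g) Π J
Nfrom-∷-true g x Π J = oddClasses-cong (λ d → +-CSemigroup.xy∙z≈y∙xz _ (classCount Π J d) (g d))

Nfrom-lowerBound : ∀ {m n} g (Π : Assignment m n) J → oddClasses g ≤ Nfrom g Π J + ∣ J ∣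
Nfrom-lowerBound g []      []          = m≤m+n (oddClasses g) 0
Nfrom-lowerBound g (x ∷ Π) (false ∷ J) = Nfrom-lowerBound g Π J
Nfrom-lowerBound g (x ∷ Π) (true ∷ J)  = begin
  oddClasses g                            ≤⟨ oddClasses-bump-≤ x g ⟩
  suc (oddClasses (bump x g))             ≤⟨ s≤s (Nfrom-lowerBound (bump x g) Π J) ⟩
  suc (Nfrom (bump x g) Π J + ∣ J ∣)      ≡⟨ +-suc _ ∣ J ∣ ⟨
  Nfrom (bump x g) Π J + suc ∣ J ∣        ≡⟨ cong (_+ suc ∣ J ∣) (Nfrom-∷-true g x Π J) ⟨
  Nfrom g (x ∷ Π) (true ∷ J) + suc ∣ J ∣  ∎
  where open ≤-Reasoning

w+b[1+w+b]≤[1+b][w+1+b] : ∀ w b → w + b * (suc w + b) ≤ suc b * (w + suc b)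
w+b[1+w+b]≤[1+b][w+1+b] w b = begin
  w + b * (suc w + b)            ≡⟨ cong (λ y → w + b * y) (+-suc w b) ⟨
  w + b * (w + suc b)            ≤⟨ +-monoˡ-≤ _ (m≤m+n w (suc b)) ⟩
  (w + suc b) + b * (w + suc b)  ∎
  where open ≤-Reasoning

Nfrom≢-bound : ∀ {m} n (J : Subset n) g →
  m * total m n (λ Π → 𝟙 (not (Nfrom g Π J ≡ᵇ oddClasses g + ∣ J ∣)))
    ≤ m ^ n * (∣ J ∣ * (oddClasses g + ∣ J ∣))
Nfrom≢-bound {m} zero [] g = begin
  m * 𝟙 (not (oddClasses g ≡ᵇ oddClasses g + 0)) ≡⟨ cong (m *_) (𝟙-not-≡ᵇ (sym (+-identityʳ (oddClasses g)))) ⟩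
  m * 0                                         ≡⟨ *-zeroʳ m ⟩
  0                                             ≤⟨ z≤n ⟩
  1 * (0 * (oddClasses g + 0))                  ∎
  where open ≤-Reasoning
Nfrom≢-bound (suc n) (false ∷ J) g =
  total-suc-≤-uniform (λ Π → 𝟙 (not (Nfrom g Π (false ∷ J) ≡ᵇ oddClasses g + ∣ J ∣))) _ (λ _ → Nfrom≢-bound n J g)
Nfrom≢-bound {m} (suc n) (true ∷ J) g = begin
  m * total m (suc n) mismatch           ≤⟨ total-suc-≤ mismatch (λ c → m * 𝟙 (isOdd (g c)) + X) per-class ⟩
  m ^ n * ∑[ c < m ] (m * 𝟙 (isOdd (g c)) + X) ≡⟨ cong (m ^ n *_) sum-per-class ⟩
  m ^ n * (m * (w + X))                 ≡⟨ *-CSemigroup.x∙yz≈yx∙z (m ^ n) m (w + X) ⟩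
  m ^ suc n * (w + X)                   ≤⟨ *-monoʳ-≤ (m ^ suc n) (w+b[1+w+b]≤[1+b][w+1+b] w ∣ J ∣) ⟩
  m ^ suc n * (suc ∣ J ∣ * (w + suc ∣ J ∣)) ∎
  where
  open ≤-Reasoning
  w = oddClasses g
  X = ∣ J ∣ * (suc w + ∣ J ∣)
  mismatch : Assignment m (suc n) → ℕ
  mismatch Π = 𝟙 (not (Nfrom g Π (true ∷ J) ≡ᵇ w + suc ∣ J ∣))
  per-class : ∀ c → m * total m n (λ Π → mismatch (c ∷ Π)) ≤ m ^ n * (m * 𝟙 (isOdd (g c)) + X)
  per-class c with isOdd (g c) in parity
  ... | true = begin
    m * total m n (λ Π → mismatch (c ∷ Π)) ≤⟨ *-monoʳ-≤ m (total-𝟙-≤ n _) ⟩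
    m * m ^ n                              ≡⟨ *-comm m (m ^ n) ⟩
    m ^ n * m                              ≡⟨ cong (m ^ n *_) (*-identityʳ m) ⟨
    m ^ n * (m * 1)                        ≤⟨ *-monoʳ-≤ (m ^ n) (m≤m+n (m * 1) X) ⟩
    m ^ n * (m * 1 + X)                    ∎
  ... | false = begin
    m * total m n (λ Π → mismatch (c ∷ Π))
      ≡⟨ cong (m *_) (total-cong n (λ Π → cong₂ (λ a b → 𝟙 (not (a ≡ᵇ b))) (Nfrom-∷-true g c Π J) target)) ⟩
    m * total m n (λ Π → 𝟙 (not (Nfrom (bump c g) Π J ≡ᵇ oddClasses (bump c g) + ∣ J ∣)))
      ≤⟨ Nfrom≢-bound n J (bump c g) ⟩
    m ^ n * (∣ J ∣ * (oddClasses (bump c g) + ∣ J ∣)) ≡⟨ cong (λ o → m ^ n * (∣ J ∣ * (o + ∣ J ∣))) bumped ⟩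
    m ^ n * X                             ≡⟨ cong (λ z → m ^ n * (z + X)) (*-zeroʳ m) ⟨
    m ^ n * (m * 0 + X)                   ∎
    where
    bumped : oddClasses (bump c g) ≡ suc w
    bumped = oddClasses-bump-even c g parity
    target : w + suc ∣ J ∣ ≡ oddClasses (bump c g) + ∣ J ∣
    target = trans (+-suc w ∣ J ∣) (cong (_+ ∣ J ∣) (sym bumped))
  sum-per-class : ∑[ c < m ] (m * 𝟙 (isOdd (g c)) + X) ≡ m * (w + X)
  sum-per-class = begin-equality
    ∑[ c < m ] (m * 𝟙 (isOdd (g c)) + X)               ≡⟨ ∑-distrib-+ (λ c → m * 𝟙 (isOdd (g c))) (λ _ → X) ⟩
    ∑[ c < m ] (m * 𝟙 (isOdd (g c))) + ∑[ c < m ] X   ≡⟨ cong₂ _+_ (*-distribˡ-sum m (λ c → 𝟙 (isOdd (g c)))) (sym (∑-const m X)) ⟨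
    m * w + m * X                                     ≡⟨ *-distribˡ-+ m w X ⟨
    m * (w + X)                                       ∎

Nfrom≤-bound-exact : ∀ {m} k n (J : Subset n) g → ∣ J ∣ ≡ suc k →
  m * total m n (λ Π → 𝟙 (not (k <ᵇ Nfrom g Π J))) ≤ m ^ n * (suc k * (k + suc k + suc k))
Nfrom≤-bound-exact {m} k n J g |J|≡1+k with k + ∣ J ∣ <? oddClasses g
... | yes many-odd = begin
  m * total m n (λ Π → 𝟙 (not (k <ᵇ Nfrom g Π J))) ≤⟨ *-monoʳ-≤ m (total-mono-≤ n never) ⟩
  m * total m n (λ _ → 0)                          ≡⟨ cong (m *_) (total-const m n 0) ⟩
  m * (m ^ n * 0)                                  ≡⟨ cong (m *_) (*-zeroʳ (m ^ n)) ⟩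
  m * 0                                            ≡⟨ *-zeroʳ m ⟩
  0                                                ≤⟨ z≤n ⟩
  m ^ n * (suc k * (k + suc k + suc k))            ∎
  where
  open ≤-Reasoning
  never : ∀ Π → 𝟙 (not (k <ᵇ Nfrom g Π J)) ≤ 0
  never Π = 𝟙-not-antitone {true} (λ _ → <⇒<ᵇ
    (+-cancelʳ-< ∣ J ∣ k (Nfrom g Π J) (<-≤-trans many-odd (Nfrom-lowerBound g Π J))))
... | no few-odd = begin
  m * total m n (λ Π → 𝟙 (not (k <ᵇ Nfrom g Π J)))
    ≤⟨ *-monoʳ-≤ m (total-mono-≤ n (λ Π → 𝟙-not-antitone (exact⇒large Π))) ⟩
  m * total m n (λ Π → 𝟙 (not (Nfrom g Π J ≡ᵇ w + ∣ J ∣)))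
    ≤⟨ Nfrom≢-bound n J g ⟩
  m ^ n * (∣ J ∣ * (w + ∣ J ∣))           ≡⟨ cong (λ j → m ^ n * (j * (w + j))) |J|≡1+k ⟩
  m ^ n * (suc k * (w + suc k))           ≤⟨ *-monoʳ-≤ (m ^ n) (*-monoʳ-≤ (suc k) (+-monoˡ-≤ (suc k) w≤)) ⟩
  m ^ n * (suc k * (k + suc k + suc k))   ∎
  where
  open ≤-Reasoning
  w = oddClasses g
  w≤ : w ≤ k + suc k
  w≤ = subst (λ j → w ≤ k + j) |J|≡1+k (≮⇒≥ few-odd)
  exact⇒large : ∀ Π → T (Nfrom g Π J ≡ᵇ w + ∣ J ∣) → T (k <ᵇ Nfrom g Π J)
  exact⇒large Π exact = <⇒<ᵇ (subst (k <_) (sym (≡ᵇ⇒≡ (Nfrom g Π J) (w + ∣ J ∣) exact))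
    (≤-trans (≤-reflexive (sym |J|≡1+k)) (m≤n+m ∣ J ∣ w)))

Nfrom≤-bound : ∀ {m} k n (J : Subset n) g → k < ∣ J ∣ →
  m * total m n (λ Π → 𝟙 (not (k <ᵇ Nfrom g Π J))) ≤ m ^ n * (suc k * (k + suc k + suc k))
Nfrom≤-bound k zero [] g ()
Nfrom≤-bound k (suc n) (false ∷ J) g k<|J| =
  total-suc-≤-uniform (λ Π → 𝟙 (not (k <ᵇ Nfrom g Π (false ∷ J)))) _ (λ _ → Nfrom≤-bound k n J g k<|J|)
Nfrom≤-bound {m} k (suc n) (true ∷ J) g k<1+|J| with k <? ∣ J ∣
... | yes k<|J| = total-suc-≤-uniform (λ Π → 𝟙 (not (k <ᵇ Nfrom g Π (true ∷ J)))) _ λ c → begin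
  m * total m n (λ Π → 𝟙 (not (k <ᵇ Nfrom g (c ∷ Π) (true ∷ J))))
    ≡⟨ cong (m *_) (total-cong n (λ Π → cong (λ a → 𝟙 (not (k <ᵇ a))) (Nfrom-∷-true g c Π J))) ⟩
  m * total m n (λ Π → 𝟙 (not (k <ᵇ Nfrom (bump c g) Π J)))
    ≤⟨ Nfrom≤-bound k n J (bump c g) k<|J| ⟩
  m ^ n * (suc k * (k + suc k + suc k))   ∎
  where open ≤-Reasoning
... | no k≮|J| = Nfrom≤-bound-exact k (suc n) (true ∷ J) g (cong suc (≤-antisym (≮⇒≥ k≮|J|) (≤-pred k<1+|J|)))

N≢∣J∣-bound : ∀ {m} n (J : Subset n) →
  m * total m n (λ Π → 𝟙 (not (N Π J ≡ᵇ ∣ J ∣))) ≤ m ^ n * (∣ J ∣ * ∣ J ∣)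
N≢∣J∣-bound {m} n J = begin
  m * total m n (λ Π → 𝟙 (not (N Π J ≡ᵇ ∣ J ∣)))
    ≡⟨ cong (m *_) (total-cong n (λ Π → cong₂ (λ a b → 𝟙 (not (a ≡ᵇ b))) (N≡Nfrom-0 Π J) (cong (_+ ∣ J ∣) (sym (oddClasses-zero m))))) ⟩
  m * total m n (λ Π → 𝟙 (not (Nfrom zeros Π J ≡ᵇ oddClasses zeros + ∣ J ∣)))
    ≤⟨ Nfrom≢-bound n J zeros ⟩
  m ^ n * (∣ J ∣ * (oddClasses zeros + ∣ J ∣))
    ≡⟨ cong (λ o → m ^ n * (∣ J ∣ * (o + ∣ J ∣))) (oddClasses-zero m) ⟩
  m ^ n * (∣ J ∣ * ∣ J ∣) ∎
  where
  open ≤-Reasoning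
  zeros : Fin m → ℕ
  zeros _ = 0

N≤k-bound : ∀ {m} k n (J : Subset n) → k < ∣ J ∣ →
  m * total m n (λ Π → 𝟙 (not (k <ᵇ N Π J))) ≤ m ^ n * (suc k * (k + suc k + suc k))
N≤k-bound {m} k n J k<|J| = begin
  m * total m n (λ Π → 𝟙 (not (k <ᵇ N Π J)))
    ≡⟨ cong (m *_) (total-cong n (λ Π → cong (λ a → 𝟙 (not (k <ᵇ a))) (N≡Nfrom-0 Π J))) ⟩
  m * total m n (λ Π → 𝟙 (not (k <ᵇ Nfrom (λ _ → 0) Π J)))
    ≤⟨ Nfrom≤-bound k n J (λ _ → 0) k<|J| ⟩
  m ^ n * (suc k * (k + suc k + suc k)) ∎
  where open ≤-Reasoning

-- 100 k² − 10 (k + 1)(3k + 2) = 70 j² + 230 j + 160 for k = j + 2.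
10·N≤k-bound<100k² : ∀ j → let k = 2 + j in 10 * (suc k * (k + suc k + suc k)) < 100 * (k * k)
10·N≤k-bound<100k² j = subst (10 * (suc k * (k + suc k + suc k)) <_) (difference j)
  (m<m+n (10 * (suc k * (k + suc k + suc k))) z<s)
  where
  k = 2 + j
  difference : ∀ j → let k = 2 + j in
    10 * (suc k * (k + suc k + suc k)) + suc (159 + 230 * j + 70 * (j * j)) ≡ 100 * (k * k)
  difference = solve-∀

lemma5 : (k n : ℕ) → 100 < k → 100 * (k * k) < n → (J : Subset n) →
    (∣ J ∣ ≤ k → 9 * ((100 * (k * k)) ^ n) < 10 * countEvent (100 * (k * k)) n (λ Π → N Π J ≡ᵇ ∣ J ∣))
    × (k < ∣ J ∣ → 9 * ((100 * (k * k)) ^ n) < 10 * countEvent (100 * (k * k)) n (λ Π → k <ᵇ N Π J))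
lemma5 zero             n ()          _ J
lemma5 (suc zero)       n (s≤s ())    _ J
lemma5 k@(suc (suc j)) n _ _ J =
    (λ ∣J∣≤k → Pr>9/10 (λ Π → N Π J ≡ᵇ ∣ J ∣) (N≢∣J∣-bound n J) (begin-strict
      10 * (∣ J ∣ * ∣ J ∣)  ≤⟨ *-monoʳ-≤ 10 (*-mono-≤ ∣J∣≤k ∣J∣≤k) ⟩
      10 * (k * k)          <⟨ *-monoˡ-< (k * k) (s≤s (m≤m+n 10 89)) ⟩
      100 * (k * k)         ∎))
  , (λ k<∣J∣ → Pr>9/10 (λ Π → k <ᵇ N Π J) (N≤k-bound k n J k<∣J∣) (10·N≤k-bound<100k² j))
  where open ≤-Reasoning
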